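{- Let $p$ be an odd prime and $r$ a positive integer. Then \[ \sum_{k=0}^{\frac{p^r-1}2}\frac{4k+3}{4(k+1)^2\,16^k}{\binom{2k}k}^2 \equiv 1-p^{2r}\pmod{p^{2r+1}}, \] and \[ \sum_{k=0}^{p^r-2}\frac{4k+3}{4(k+1)^2\,16^k}{\binom{2k}k}^2 \equiv 1-p^{2r}\pmod{p^{2r+1}}. \]
   Context: Congruences between rational numbers modulo $p^{m}$ are understood in the ring of rationals whose denominators are coprime to $p$ (i.e. $A\equiv B\pmod{p^m}$ means $A-B$ equals $p^m$ times a $p$-integral rational number). -}

module Defs where

open import Data.Nat as ℕ using (ℕ; zero; suc; NonZero)
open import Data.Nat.Properties using (m*n≢0; m^n≢0)
open import Data.Nat.Combinatorics using (_C_)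
open import Data.Nat.Divisibility using (_∣_)
open import Data.Integer using (ℤ; +_)
open import Data.Rational using (ℚ; _/_; 0ℚ) renaming (_+_ to _+ℚ_; _-_ to _-ℚ_; _*_ to _*ℚ_)
open import Data.Product using (∃; _×_)
open import Relation.Nullary using (¬_)
open import Relation.Binary.PropositionalEquality using (_≡_)

den : ℕ → ℕ
den k = 4 ℕ.* (suc k ℕ.^ 2) ℕ.* (16 ℕ.^ k)

den-nonZero : ∀ k → NonZero (den k)
den-nonZero k = m*n≢0 (4 ℕ.* (suc k ℕ.^ 2)) (16 ℕ.^ k)
  where
  instance
    _ = m^n≢0 (suc k) 2
    _ = m^n≢0 16 k
    _ = m*n≢0 4 (suc k ℕ.^ 2)

term : ℕ → ℚ
term k = (+ ((4 ℕ.* k ℕ.+ 3) ℕ.* ((2 ℕ.* k) C k) ℕ.^ 2)) / den k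
  where instance _ = den-nonZero k

-- Σ_{k=0}^{n} f k  (upper limit inclusive)
sumTo : ℕ → (ℕ → ℚ) → ℚ
sumTo zero    f = f 0
sumTo (suc n) f = sumTo n f +ℚ f (suc n)

-- A ≡ B (mod p^m) in the ring of p-integral rationals:
-- A - B = p^m * (a / b) for some integer a and natural b with p ∤ b.
-- (Stated multiplicatively: (A - B) * b = p^m * a.)
_≡_[modPow_^_] : ℚ → ℚ → ℕ → ℕ → Set
A ≡ B [modPow p ^ m ] =
  ∃ λ (a : ℤ) → ∃ λ (b : ℕ) →
    (¬ (p ∣ b)) × ((A -ℚ B) *ℚ (+ b / 1) ≡ (+ (p ℕ.^ m) / 1) *ℚ (a / 1))

module Submission where

-- The summand telescopes: with A k = C(2k,k)^2 / 16^k it equals A k - A (k+1), so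
-- the partial sum up to n is 1 - A (n+1).  Writing q = 2h+1, the two tails are
-- A (h+1) and A (2h), and the ratio (k+1) C(2k+2,k+1) = 2 (2k+1) C(2k,k) shows that
-- each is q² times a p-integral number; it remains to see that this number is ≡ 1
-- modulo p.  That follows from the behaviour of Pascal's triangle modulo p near the
-- row q, whose interior entries are divisible by p:  C(q-1,k) ≡ (-1)^k,
-- C(2q,q) ≡ 2 and 2^q ≡ 2.

open import Defs
open import Data.Nat using (ℕ; _*_; _+_; _^_; _∸_; _≤_)
open import Relation.Binary.PropositionalEquality using (_≢_)
open import Data.Nat.DivMod using (_/_)
open import Data.Nat.Primality using (Prime)
open import Data.Integer using (+_)
open import Data.Rational using (1ℚ) renaming (_/_ to _/ℚ_; _-_ to _-ℚ_)
open import Data.Product using (_×_)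

open import Data.Nat as ℕ using (zero; suc; _<_; z≤n; s≤s; NonZero)
open import Data.Nat.Properties
  using (+-identityʳ; +-suc; *-comm; *-assoc; *-identityˡ; *-identityʳ; *-zeroʳ; *-suc; *-cancelˡ-≡;
         ^-distribˡ-+-*; ^-*-assoc; ≤-refl; ≤-trans; ≤-antisym; <-irrefl; n≤1+n; n<1+n;
         m≤m+n; m≤n⇒m≤1+n; m+n∸n≡m; m*n≢0; m^n≢0)
open import Data.Nat.Divisibility
  using (_∣_; divides; _∣?_; ∣-trans; m∣m*n; ∣1⇒≡1; ∣⇒≤; 1∣_; *-cancelˡ-∣; *-monoʳ-∣; ∣n⇒∣m*n; m%n≡0⇒n∣m; _∣0)
open import Data.Nat.DivMod using (_%_; m≡m%n+[m/n]*n; m%n<n; m*n/n≡m)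
open import Data.Nat.Primality using (euclidsLemma; prime⇒nonZero; prime⇒nonTrivial; prime⇒irreducible; prime[2])
open import Data.Nat.Combinatorics using (_C_; nCk+nC[k+1]≡[n+1]C[k+1]; k>n⇒nCk≡0; nCk≡nC[n∸k]; nC1≡n; nCn≡1)
import Data.Nat.Tactic.RingSolver as ℕ-Ring
open import Data.Integer as ℤ using (ℤ; 0ℤ; -_)
import Data.Integer.Properties as ℤP
open import Data.Integer.Divisibility.Signed as ℤ∣
  using (∣ᵤ⇒∣; ∣⇒∣ᵤ; ∣m∣n⇒∣m+n; ∣m⇒∣-m; ∣m⇒∣m*n; ∣m+n∣m⇒∣n) renaming (_∣_ to _∣ℤ_)
import Data.Integer.Tactic.RingSolver as ℤ-Ring
open import Data.Rational as ℚ using (ℚ; toℚᵘ)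
import Data.Rational.Properties as ℚP
open import Data.Rational.Solver using (module +-*-Solver)
open import Data.Rational.Unnormalised as ℚᵘ using (mkℚᵘ; *≡*)
import Data.Rational.Unnormalised.Properties as ℚᵘP
open import Data.Product using (∃; _,_)
open import Data.Sum using (inj₁; inj₂)
open import Data.Empty using (⊥-elim)
open import Relation.Nullary using (¬_; yes; no)
open import Relation.Binary.Bundles using (Setoid)
open import Relation.Binary.PropositionalEquality
  using (_≡_; refl; sym; trans; cong; cong₂; subst; subst₂; module ≡-Reasoning)
import Relation.Binary.Reasoning.Setoid as SetoidReasoning

private
  module ℚ-Ring = +-*-Solver

pascal : ∀ n k → suc n C suc k ≡ n C k + n C suc k
pascal n k = sym (nCk+nC[k+1]≡[n+1]C[k+1] n k)

private
  absorb-split : ∀ k a b → suc (suc k) * (a + b) ≡ (suc k * a + a) + suc (suc k) * b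
  absorb-split = ℕ-Ring.solve-∀
  absorb-merge : ∀ n x y a → (suc n * x + a) + suc n * y ≡ suc n * (x + y) + a
  absorb-merge = ℕ-Ring.solve-∀
  absorb-collect : ∀ n a → suc n * a + a ≡ suc (suc n) * a
  absorb-collect = ℕ-Ring.solve-∀

absorb : ∀ n k → suc k * (suc n C suc k) ≡ suc n * (n C k)
absorb zero zero = refl
absorb zero (suc k) = begin
  suc (suc k) * (1 C suc (suc k)) ≡⟨ cong (suc (suc k) *_) (k>n⇒nCk≡0 {1} {suc (suc k)} (s≤s (s≤s z≤n))) ⟩
  suc (suc k) * 0                 ≡⟨ *-zeroʳ (suc (suc k)) ⟩
  0                               ≡⟨ cong (1 *_) (k>n⇒nCk≡0 {0} {suc k} (s≤s z≤n)) ⟨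
  1 * (0 C suc k)                 ∎
  where open ≡-Reasoning
absorb (suc n) zero = begin
  1 * (suc (suc n) C 1) ≡⟨ *-identityˡ _ ⟩
  suc (suc n) C 1       ≡⟨ nC1≡n (suc (suc n)) ⟩
  suc (suc n)           ≡⟨ *-identityʳ (suc (suc n)) ⟨
  suc (suc n) * 1       ∎
  where open ≡-Reasoning
absorb (suc n) (suc k) = begin
  suc (suc k) * (suc (suc n) C suc (suc k))   ≡⟨ cong (suc (suc k) *_) (pascal (suc n) (suc k)) ⟩
  suc (suc k) * (a + b)                       ≡⟨ absorb-split k a b ⟩
  (suc k * a + a) + suc (suc k) * b           ≡⟨ cong₂ (λ u v → (u + a) + v) (absorb n k) (absorb n (suc k)) ⟩
  (suc n * (n C k) + a) + suc n * (n C suc k) ≡⟨ absorb-merge n (n C k) (n C suc k) a ⟩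
  suc n * (n C k + n C suc k) + a             ≡⟨ cong (λ u → suc n * u + a) (pascal n k) ⟨
  suc n * a + a                               ≡⟨ absorb-collect n a ⟩
  suc (suc n) * a                             ∎
  where
  open ≡-Reasoning
  a = suc n C suc k
  b = suc n C suc (suc k)

central : ℕ → ℕ
central k = (2 * k) C k

private
  double-suc : ∀ k → 2 * suc k ≡ suc (suc (2 * k))
  double-suc = ℕ-Ring.solve-∀
  odd-split : ∀ k → suc (2 * k) ≡ suc k + k
  odd-split = ℕ-Ring.solve-∀
  double-assoc : ∀ k c → suc (suc (2 * k)) * c ≡ 2 * (suc k * c)
  double-assoc = ℕ-Ring.solve-∀

central-ratio : ∀ k → suc k * central (suc k) ≡ 2 * (suc (2 * k) * central k)
central-ratio k = begin
  suc k * ((2 * suc k) C suc k)             ≡⟨ cong (λ m → suc k * (m C suc k)) (double-suc k) ⟩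
  suc k * (suc (suc (2 * k)) C suc k)       ≡⟨ absorb (suc (2 * k)) k ⟩
  suc (suc (2 * k)) * (suc (2 * k) C k)     ≡⟨ cong (suc (suc (2 * k)) *_) middle-symmetry ⟩
  suc (suc (2 * k)) * (suc (2 * k) C suc k) ≡⟨ double-assoc k (suc (2 * k) C suc k) ⟩
  2 * (suc k * (suc (2 * k) C suc k))       ≡⟨ cong (2 *_) (absorb (2 * k) k) ⟩
  2 * (suc (2 * k) * central k)             ∎
  where
  open ≡-Reasoning
  middle-symmetry : suc (2 * k) C k ≡ suc (2 * k) C suc k
  middle-symmetry = begin
    suc (2 * k) C k                 ≡⟨ nCk≡nC[n∸k] (m≤n⇒m≤1+n (m≤m+n k (k + 0))) ⟩
    suc (2 * k) C (suc (2 * k) ∸ k) ≡⟨ cong (λ m → suc (2 * k) C (m ∸ k)) (odd-split k) ⟩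
    suc (2 * k) C (suc k + k ∸ k)   ≡⟨ cong (suc (2 * k) C_) (m+n∸n≡m (suc k) k) ⟩
    suc (2 * k) C suc k             ∎

rowSum : ℕ → ℕ → ℕ
rowSum n zero    = n C 0
rowSum n (suc j) = rowSum n j + n C suc j

private
  regroup : ∀ a b c d → (a + b) + (c + d) ≡ (a + d) + (b + c)
  regroup = ℕ-Ring.solve-∀
  shift-one : ∀ n → suc (suc n) ≡ suc n + 1
  shift-one = ℕ-Ring.solve-∀
  doubling : ∀ a → (a + 0) + a ≡ 2 * a
  doubling = ℕ-Ring.solve-∀

rowSum-pascal : ∀ n j → rowSum (suc n) (suc j) ≡ rowSum n (suc j) + rowSum n j
rowSum-pascal n zero = begin
  1 + suc n C 1   ≡⟨ cong suc (nC1≡n (suc n)) ⟩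
  suc (suc n)     ≡⟨ shift-one n ⟩
  suc n + 1       ≡⟨ cong (λ m → suc m + 1) (nC1≡n n) ⟨
  (1 + n C 1) + 1 ∎
  where open ≡-Reasoning
rowSum-pascal n (suc j) = begin
  rowSum (suc n) (suc j) + suc n C suc (suc j)
    ≡⟨ cong₂ _+_ (rowSum-pascal n j) (pascal n (suc j)) ⟩
  (rowSum n (suc j) + rowSum n j) + (n C suc j + n C suc (suc j))
    ≡⟨ regroup (rowSum n (suc j)) (rowSum n j) (n C suc j) (n C suc (suc j)) ⟩
  rowSum n (suc (suc j)) + rowSum n (suc j) ∎
  where open ≡-Reasoning

rowSum-full : ∀ n → rowSum n n ≡ 2 ^ n
rowSum-full zero = refl
rowSum-full (suc n) = begin
  rowSum (suc n) (suc n)                ≡⟨ rowSum-pascal n n ⟩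
  (rowSum n n + n C suc n) + rowSum n n ≡⟨ cong₂ (λ u v → (u + v) + u) (rowSum-full n) (k>n⇒nCk≡0 {n} {suc n} ≤-refl) ⟩
  (2 ^ n + 0) + 2 ^ n                   ≡⟨ doubling (2 ^ n) ⟩
  2 ^ suc n                             ∎
  where open ≡-Reasoning

module _ {p : ℕ} (p-prime : Prime p) where

  private instance
    p≢0 : NonZero p
    p≢0 = prime⇒nonZero p-prime

  prime>1 : 1 < p
  prime>1 = ℕ.nonTrivial⇒n>1 p {{prime⇒nonTrivial p-prime}}

  prime∤1 : ¬ p ∣ 1
  prime∤1 p∣1 = <-irrefl (sym (∣1⇒≡1 p∣1)) prime>1

  prime-∣-^ : ∀ {m} k → p ∣ m ^ k → p ∣ m
  prime-∣-^ zero    p∣1 = ⊥-elim (prime∤1 p∣1)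
  prime-∣-^ (suc k) p∣m*mᵏ with euclidsLemma _ _ p-prime p∣m*mᵏ
  ... | inj₁ p∣m  = p∣m
  ... | inj₂ p∣mᵏ = prime-∣-^ k p∣mᵏ

  private
    pull-out : ∀ a b c → a * b * c ≡ b * (a * c)
    pull-out a b c = trans (cong (_* c) (*-comm a b)) (*-assoc b a c)

  prime-power-∣-cancel : ∀ r {k c} → p ^ r ∣ k * c → ¬ p ∣ c → p ^ r ∣ k
  prime-power-∣-cancel zero    {k}     _ _ = 1∣ k
  prime-power-∣-cancel (suc r) {k} {c} pʳ⁺¹∣kc p∤c
    with euclidsLemma k c p-prime (∣-trans (m∣m*n (p ^ r)) pʳ⁺¹∣kc)
  ... | inj₂ p∣c = ⊥-elim (p∤c p∣c)
  ... | inj₁ (divides k′ refl) = subst (p ^ suc r ∣_) (*-comm p k′)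
        (*-monoʳ-∣ p (prime-power-∣-cancel r (*-cancelˡ-∣ p (subst (p ^ suc r ∣_) (pull-out k′ p c) pʳ⁺¹∣kc)) p∤c))

  -- The interior binomial coefficients of a row p^r are divisible by p:
  -- k C(q,k) = q C(q-1,k-1) is a multiple of q = p^r, while q ∤ k.
  prime-power-∣-binomial : ∀ r {k} → 0 < k → k < p ^ r → p ∣ (p ^ r) C k
  prime-power-∣-binomial r {suc j} _ k<pʳ with p ^ r in pʳ≡
  prime-power-∣-binomial r {suc j} _ () | zero
  ... | suc n with p ∣? (suc n C suc j)
  ...   | yes p∣C = p∣C
  ...   | no  p∤C = ⊥-elim (<-irrefl refl (≤-trans k<pʳ (∣⇒≤ pʳ∣k)))
    where
    pʳ∣k : suc n ∣ suc j
    pʳ∣k = subst (_∣ suc j) pʳ≡ (prime-power-∣-cancel r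
             (subst (_∣ suc j * (suc n C suc j)) (sym pʳ≡)
               (divides (n C j) (trans (absorb n j) (*-comm (suc n) (n C j)))))
             p∤C)

odd : ∀ m → ¬ 2 ∣ m → ∃ λ h → m ≡ suc (2 * h)
odd m 2∤m with m % 2 in m%2≡ | m%n<n m 2
... | zero        | _ = ⊥-elim (2∤m (m%n≡0⇒n∣m m 2 m%2≡))
... | suc zero    | _ = m / 2 , trans (m≡m%n+[m/n]*n m 2)
      (trans (cong (λ t → t + m / 2 * 2) m%2≡) (cong suc (*-comm (m / 2) 2)))
... | suc (suc _) | s≤s (s≤s ())

module _ {p : ℕ} (p-prime : Prime p) (p≢2 : p ≢ 2) where

  prime∤2^ : ∀ k → ¬ p ∣ 2 ^ k
  prime∤2^ k p∣2ᵏ = p≢2 (≤-antisym (∣⇒≤ (prime-∣-^ p-prime k p∣2ᵏ)) (prime>1 p-prime))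

  odd-power : ∀ r → ∃ λ h → p ^ r ≡ suc (2 * h)
  odd-power r = odd (p ^ r) 2∤pʳ
    where
    2∤pʳ : ¬ 2 ∣ p ^ r
    2∤pʳ 2∣pʳ with prime⇒irreducible p-prime (prime-∣-^ prime[2] r 2∣pʳ)
    ... | inj₁ ()
    ... | inj₂ 2≡p = p≢2 (sym 2≡p)

∣-power : ∀ {m r} → 1 ≤ r → m ∣ m ^ r
∣-power {m} {suc r} _ = m∣m*n (m ^ r)

power-double : ∀ m r → m ^ (2 * r) ≡ m ^ r * m ^ r
power-double m r = trans (cong (λ n → m ^ (r + n)) (+-identityʳ r)) (^-distribˡ-+-* m r r)

power-succ : ∀ m n → m ^ (n + 1) ≡ m ^ n * m
power-succ m n = trans (^-distribˡ-+-* m n 1) (cong (m ^ n *_) (*-identityʳ m))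

-- The summation ranges for q = 2h+1:  (q-1)/2 = h  and  (q-2)+1 = 2h  (if q ≠ 1).
half-index : ∀ h → (suc (2 * h) ∸ 1) / 2 ≡ h
half-index h = trans (cong (_/ 2) (*-comm 2 h)) (m*n/n≡m h 2)

last-index : ∀ {p h} → Prime p → p ∣ suc (2 * h) → suc (suc (2 * h) ∸ 2) ≡ 2 * h
last-index {h = zero}  p-prime p∣1 = ⊥-elim (prime∤1 p-prime p∣1)
last-index {h = suc h} _     _   = refl

module Congruence (n : ℕ) where

  -- a record rather than a definition, so that x and y stay inferable
  infix 4 _≈_
  record _≈_ (x y : ℤ) : Set where
    constructor congruent
    field divides-difference : + n ∣ℤ x ℤ.- y
  open _≈_

  private
    via : ∀ {e} x y → e ≡ x ℤ.- y → + n ∣ℤ e → x ≈ y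
    via _ _ eq n∣e = congruent (subst (+ n ∣ℤ_) eq n∣e)

    refl-diff : ∀ x → 0ℤ ≡ x ℤ.- x
    refl-diff = ℤ-Ring.solve-∀
    sym-diff : ∀ x y → - (x ℤ.- y) ≡ y ℤ.- x
    sym-diff = ℤ-Ring.solve-∀
    trans-diff : ∀ x y z → (x ℤ.- y) ℤ.+ (y ℤ.- z) ≡ x ℤ.- z
    trans-diff = ℤ-Ring.solve-∀
    +-diff : ∀ x y u v → (x ℤ.- y) ℤ.+ (u ℤ.- v) ≡ (x ℤ.+ u) ℤ.- (y ℤ.+ v)
    +-diff = ℤ-Ring.solve-∀
    *-diff : ∀ x y u v → (x ℤ.- y) ℤ.* u ℤ.+ y ℤ.* (u ℤ.- v) ≡ x ℤ.* u ℤ.- y ℤ.* v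
    *-diff = ℤ-Ring.solve-∀
    neg-diff : ∀ x y → - (x ℤ.- y) ≡ - x ℤ.- - y
    neg-diff = ℤ-Ring.solve-∀

  ≈-refl : ∀ {x} → x ≈ x
  ≈-refl {x} = via x x (refl-diff x) (∣ᵤ⇒∣ (n ∣0))

  ≈-sym : ∀ {x y} → x ≈ y → y ≈ x
  ≈-sym {x} {y} x≈y = via y x (sym-diff x y) (∣m⇒∣-m (divides-difference x≈y))

  ≈-trans : ∀ {x y z} → x ≈ y → y ≈ z → x ≈ z
  ≈-trans {x} {y} {z} x≈y y≈z =
    via x z (trans-diff x y z) (∣m∣n⇒∣m+n (divides-difference x≈y) (divides-difference y≈z))

  ≈-reflexive : ∀ {x y} → x ≡ y → x ≈ y
  ≈-reflexive refl = ≈-refl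

  ≈-setoid : Setoid _ _
  ≈-setoid = record
    { Carrier = ℤ ; _≈_ = _≈_
    ; isEquivalence = record { refl = ≈-refl ; sym = ≈-sym ; trans = ≈-trans } }

  module ≈-Reasoning = SetoidReasoning ≈-setoid

  +-cong : ∀ {x y u v} → x ≈ y → u ≈ v → x ℤ.+ u ≈ y ℤ.+ v
  +-cong {x} {y} {u} {v} x≈y u≈v = via (x ℤ.+ u) (y ℤ.+ v) (+-diff x y u v)
    (∣m∣n⇒∣m+n (divides-difference x≈y) (divides-difference u≈v))

  *-cong : ∀ {x y u v} → x ≈ y → u ≈ v → x ℤ.* u ≈ y ℤ.* v
  *-cong {x} {y} {u} {v} x≈y u≈v = via (x ℤ.* u) (y ℤ.* v) (*-diff x y u v)
    (∣m∣n⇒∣m+n (∣m⇒∣m*n u (divides-difference x≈y)) (ℤ∣.∣n⇒∣m*n y (divides-difference u≈v)))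

  neg-cong : ∀ {x y} → x ≈ y → - x ≈ - y
  neg-cong {x} {y} x≈y = via (- x) (- y) (neg-diff x y) (∣m⇒∣-m (divides-difference x≈y))

  ∣⇒≈0 : ∀ {m} → n ∣ m → + m ≈ 0ℤ
  ∣⇒≈0 {m} n∣m = via (+ m) 0ℤ (sym (ℤP.+-identityʳ (+ m))) (∣ᵤ⇒∣ n∣m)

  ≈-∣ : ∀ {m k} → + m ≈ + k → n ∣ m → n ∣ k
  ≈-∣ {m} {k} m≈k n∣m = ∣⇒∣ᵤ (subst (+ n ∣ℤ_) (ℤP.neg-involutive (+ k))
    (∣m⇒∣-m (∣m+n∣m⇒∣n {m = + m} (divides-difference m≈k) (∣ᵤ⇒∣ n∣m))))

  +-cong-ℕ : ∀ {a b c d} → + a ≈ + b → + c ≈ + d → + (a + c) ≈ + (b + d)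
  +-cong-ℕ {a} {b} {c} {d} a≈b c≈d =
    subst₂ _≈_ (sym (ℤP.pos-+ a c)) (sym (ℤP.pos-+ b d)) (+-cong a≈b c≈d)

  *-cong-ℕ : ∀ {a b c d} → + a ≈ + b → + c ≈ + d → + (a * c) ≈ + (b * d)
  *-cong-ℕ {a} {b} {c} {d} a≈b c≈d =
    subst₂ _≈_ (sym (ℤP.pos-* a c)) (sym (ℤP.pos-* b d)) (*-cong a≈b c≈d)

  *-self-ℕ : ∀ {a x} → + a ≈ x → + (a * a) ≈ x ℤ.* x
  *-self-ℕ {a} a≈x = subst (_≈ _) (sym (ℤP.pos-* a a)) (*-cong a≈x a≈x)

sign : ℕ → ℤ
sign zero    = + 1
sign (suc k) = - sign k

private
  neg-square : ∀ x → - x ℤ.* - x ≡ x ℤ.* x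
  neg-square = ℤ-Ring.solve-∀

sign-square : ∀ k → sign k ℤ.* sign k ≡ + 1
sign-square zero    = refl
sign-square (suc k) = trans (neg-square (sign k)) (sign-square k)

-- Rows of Pascal's triangle modulo p around a row q = n+1 all of whose interior
-- entries C(q,k), 0 < k < q, are divisible by p (for instance q a power of p).
module InteriorDivisible (p n : ℕ) (interior : ∀ {k} → 0 < k → k < suc n → p ∣ suc n C k) where

  open Congruence p
  open ≈-Reasoning

  q : ℕ
  q = suc n

  shift : ∀ m j → j < q → + ((q + m) C j) ≈ + (m C j)
  shift m       zero    _  = ≈-refl
  shift zero    (suc j) lt = begin
    + ((q + 0) C suc j) ≡⟨ cong (λ t → + (t C suc j)) (+-identityʳ q) ⟩
    + (q C suc j)       ≈⟨ ∣⇒≈0 (interior (s≤s z≤n) lt) ⟩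
    0ℤ                  ≡⟨ cong +_ (k>n⇒nCk≡0 {0} {suc j} (s≤s z≤n)) ⟨
    + (0 C suc j)       ∎
  shift (suc m) (suc j) lt = begin
    + ((q + suc m) C suc j)           ≡⟨ cong (λ t → + (t C suc j)) (+-suc q m) ⟩
    + (suc (q + m) C suc j)           ≡⟨ cong +_ (pascal (q + m) j) ⟩
    + ((q + m) C j + (q + m) C suc j) ≈⟨ +-cong-ℕ (shift m j (≤-trans (n≤1+n _) lt)) (shift m (suc j) lt) ⟩
    + (m C j + m C suc j)             ≡⟨ cong +_ (pascal m j) ⟨
    + (suc m C suc j)                 ∎

  private
    double-row : ∀ n → suc (suc n + n) ≡ 2 * suc n
    double-row = ℕ-Ring.solve-∀
    double-comm : ∀ q c → (2 * q) * c ≡ q * (2 * c)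
    double-comm = ℕ-Ring.solve-∀
    add-sub : ∀ a b → (a ℤ.+ b) ℤ.- a ≡ b
    add-sub = ℤ-Ring.solve-∀

  central-≈-2 : + central q ≈ + 2
  central-≈-2 = begin
    + central q           ≡⟨ cong +_ halve ⟩
    + (2 * ((q + n) C n)) ≈⟨ *-cong-ℕ {2} ≈-refl (shift n n (n<1+n n)) ⟩
    + (2 * (n C n))       ≡⟨ cong (λ t → + (2 * t)) (nCn≡1 n) ⟩
    + 2                   ∎
    where
    -- q C(2q,q) = 2q C(2q-1,q-1), by absorption
    halve : central q ≡ 2 * ((q + n) C n)
    halve = *-cancelˡ-≡ (central q) (2 * ((q + n) C n)) q (trans
      (trans (cong (λ t → q * (t C q)) (sym (double-row n))) (absorb (q + n) n))
      (trans (cong (_* ((q + n) C n)) (double-row n)) (double-comm q ((q + n) C n))))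

  alternating : ∀ k → k ≤ n → + (n C k) ≈ sign k
  alternating zero    _   = ≈-refl
  alternating (suc k) k<n = begin
    + (n C suc k)               ≡⟨ pascal-difference ⟩
    + (q C suc k) ℤ.- + (n C k) ≈⟨ +-cong (∣⇒≈0 (interior (s≤s z≤n) (s≤s k<n))) (neg-cong (alternating k (≤-trans (n≤1+n k) k<n))) ⟩
    0ℤ ℤ.- sign k               ≡⟨ ℤP.+-identityˡ (- sign k) ⟩
    sign (suc k)                ∎
    where
    pascal-difference : + (n C suc k) ≡ + (q C suc k) ℤ.- + (n C k)
    pascal-difference = sym (trans
      (cong (ℤ._- + (n C k)) (trans (cong +_ (pascal n k)) (ℤP.pos-+ (n C k) (n C suc k))))
      (add-sub (+ (n C k)) (+ (n C suc k))))

  partial-rowSum-≈-1 : ∀ j → j < q → + rowSum q j ≈ + 1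
  partial-rowSum-≈-1 zero    _  = ≈-refl
  partial-rowSum-≈-1 (suc j) lt = begin
    + (rowSum q j + q C suc j)     ≡⟨ ℤP.pos-+ (rowSum q j) (q C suc j) ⟩
    + rowSum q j ℤ.+ + (q C suc j) ≈⟨ +-cong (partial-rowSum-≈-1 j (≤-trans (n≤1+n _) lt)) (∣⇒≈0 (interior (s≤s z≤n) lt)) ⟩
    + 1 ℤ.+ 0ℤ                     ≡⟨ ℤP.+-identityʳ (+ 1) ⟩
    + 1                            ∎

  two-pow : + (2 ^ q) ≈ + 2
  two-pow = begin
    + (2 ^ q)              ≡⟨ cong +_ (rowSum-full q) ⟨
    + (rowSum q n + q C q) ≈⟨ +-cong-ℕ (partial-rowSum-≈-1 n (n<1+n n)) (≈-reflexive (cong +_ (nCn≡1 q))) ⟩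
    + 2                    ∎

  two-pow-multiple : ∀ j → + (2 ^ (q * j)) ≈ + (2 ^ j)
  two-pow-multiple zero    = ≈-reflexive (cong (λ t → + (2 ^ t)) (*-zeroʳ q))
  two-pow-multiple (suc j) = begin
    + (2 ^ (q * suc j))     ≡⟨ cong (λ t → + (2 ^ t)) (*-suc q j) ⟩
    + (2 ^ (q + q * j))     ≡⟨ cong +_ (^-distribˡ-+-* 2 q (q * j)) ⟩
    + (2 ^ q * 2 ^ (q * j)) ≈⟨ *-cong-ℕ two-pow (two-pow-multiple j) ⟩
    + (2 ^ suc j)           ∎

toℚᵘ-/ : ∀ x d .{{_ : NonZero d}} → toℚᵘ (x ℚ./ d) ℚᵘ.≃ mkℚᵘ x (ℕ.pred d)
toℚᵘ-/ x (suc d) = ℚP.toℚᵘ-fromℚᵘ (mkℚᵘ x d)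

/-cross : ∀ {x y : ℤ} {d e : ℕ} .{{_ : NonZero d}} .{{_ : NonZero e}} →
          x ℤ.* + e ≡ y ℤ.* + d → x ℚ./ d ≡ y ℚ./ e
/-cross {x} {y} {suc d} {suc e} eq = ℚP.fromℚᵘ-cong {mkℚᵘ x d} {mkℚᵘ y e} (*≡* eq)

/-+ : ∀ (x y : ℤ) (d e : ℕ) .{{_ : NonZero d}} .{{_ : NonZero e}} →
      x ℚ./ d ℚ.+ y ℚ./ e ≡ ((x ℤ.* + e ℤ.+ y ℤ.* + d) ℚ./ (d * e)) {{m*n≢0 d e}}
/-+ x y (suc d) (suc e) = ℚP.toℚᵘ-injective (begin
    toℚᵘ (x ℚ./ suc d ℚ.+ y ℚ./ suc e)
      ≈⟨ ℚP.toℚᵘ-homo-+ (x ℚ./ suc d) (y ℚ./ suc e) ⟩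
    toℚᵘ (x ℚ./ suc d) ℚᵘ.+ toℚᵘ (y ℚ./ suc e)
      ≈⟨ ℚᵘP.+-cong (toℚᵘ-/ x (suc d)) (toℚᵘ-/ y (suc e)) ⟩
    mkℚᵘ x d ℚᵘ.+ mkℚᵘ y e
      ≈⟨ ℚᵘP.≃-sym (toℚᵘ-/ _ (suc d * suc e)) ⟩
    toℚᵘ ((x ℤ.* + suc e ℤ.+ y ℤ.* + suc d) ℚ./ (suc d * suc e)) ∎)
  where open SetoidReasoning ℚᵘP.≃-setoid

/-* : ∀ (x y : ℤ) (d e : ℕ) .{{_ : NonZero d}} .{{_ : NonZero e}} →
      (x ℚ./ d) ℚ.* (y ℚ./ e) ≡ ((x ℤ.* y) ℚ./ (d * e)) {{m*n≢0 d e}}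
/-* x y (suc d) (suc e) = ℚP.toℚᵘ-injective (begin
    toℚᵘ (x ℚ./ suc d ℚ.* (y ℚ./ suc e))       ≈⟨ ℚP.toℚᵘ-homo-* (x ℚ./ suc d) (y ℚ./ suc e) ⟩
    toℚᵘ (x ℚ./ suc d) ℚᵘ.* toℚᵘ (y ℚ./ suc e) ≈⟨ ℚᵘP.*-cong (toℚᵘ-/ x (suc d)) (toℚᵘ-/ y (suc e)) ⟩
    mkℚᵘ x d ℚᵘ.* mkℚᵘ y e                     ≈⟨ ℚᵘP.≃-sym (toℚᵘ-/ _ (suc d * suc e)) ⟩
    toℚᵘ ((x ℤ.* y) ℚ./ (suc d * suc e))       ∎)
  where open SetoidReasoning ℚᵘP.≃-setoid

ι : ℤ → ℚ
ι z = z ℚ./ 1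

ι-+ : ∀ x y → ι (x ℤ.+ y) ≡ ι x ℚ.+ ι y
ι-+ x y = sym (trans (/-+ x y 1 1) (cong ι (cong₂ ℤ._+_ (ℤP.*-identityʳ x) (ℤP.*-identityʳ y))))

ι-* : ∀ x y → ι (x ℤ.* y) ≡ ι x ℚ.* ι y
ι-* x y = sym (/-* x y 1 1)

/-*-cancel : ∀ x d .{{_ : NonZero d}} → (x ℚ./ d) ℚ.* ι (+ d) ≡ ι x
/-*-cancel x d = trans (/-* x (+ d) d 1) (/-cross {x ℤ.* + d} {x} {d * 1} {1} {{m*n≢0 d 1}} (begin
    x ℤ.* + d ℤ.* + 1 ≡⟨ ℤP.*-identityʳ (x ℤ.* + d) ⟩
    x ℤ.* + d         ≡⟨ cong (λ n → x ℤ.* + n) (*-identityʳ d) ⟨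
    x ℤ.* + (d * 1)   ∎))
  where open ≡-Reasoning

/-cross-ℕ : ∀ (a b d e : ℕ) .{{_ : NonZero d}} .{{_ : NonZero e}} →
            a * e ≡ b * d → + a ℚ./ d ≡ + b ℚ./ e
/-cross-ℕ a b d e eq =
  /-cross {+ a} {+ b} {d} {e} (trans (sym (ℤP.pos-* a e)) (trans (cong +_ eq) (ℤP.pos-* b d)))

/-+-ℕ : ∀ (a b d e : ℕ) .{{_ : NonZero d}} .{{_ : NonZero e}} →
        + a ℚ./ d ℚ.+ + b ℚ./ e ≡ (+ (a * e + b * d) ℚ./ (d * e)) {{m*n≢0 d e}}
/-+-ℕ a b d e = trans (/-+ (+ a) (+ b) d e) (cong (λ z → (z ℚ./ (d * e)) {{m*n≢0 d e}})
  (sym (trans (ℤP.pos-+ (a * e) (b * d)) (cong₂ ℤ._+_ (ℤP.pos-* a e) (ℤP.pos-* b d)))))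

A : ℕ → ℚ
A k = (+ (central k ^ 2) ℚ./ 16 ^ k) {{m^n≢0 16 k}}

-- (the squares are spelt out as x * (x * 1), which is what x ^ 2 unfolds to)
private
  tail-step-expand : ∀ k c d → c * (c * 1) * (4 * (suc k * (suc k * 1)) * d * (16 * d))
    ≡ (4 * k + 3) * (c * (c * 1)) * (16 * d) * d
      + 4 * d * d * ((2 * (suc (2 * k) * c)) * ((2 * (suc (2 * k) * c)) * 1))
  tail-step-expand = ℕ-Ring.solve-∀
  tail-step-collect : ∀ k c c′ d
    → (4 * k + 3) * (c * (c * 1)) * (16 * d) * d + 4 * d * d * ((suc k * c′) * ((suc k * c′) * 1))
    ≡ ((4 * k + 3) * (c * (c * 1)) * (16 * d) + c′ * (c′ * 1) * (4 * (suc k * (suc k * 1)) * d)) * d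
  tail-step-collect = ℕ-Ring.solve-∀

tail-step : ∀ k → A k ≡ term k ℚ.+ A (suc k)
tail-step k = trans
  (/-cross-ℕ (c ^ 2) (a * 16 ^ suc k + b * den k) d (den k * 16 ^ suc k)
    {{m^n≢0 16 k}} {{m*n≢0 (den k) (16 ^ suc k) {{den-nonZero k}} {{m^n≢0 16 (suc k)}}}} cross)
  (sym (/-+-ℕ a b (den k) (16 ^ suc k) {{den-nonZero k}} {{m^n≢0 16 (suc k)}}))
  where
  open ≡-Reasoning
  c = central k
  d = 16 ^ k
  a = (4 * k + 3) * c ^ 2
  b = central (suc k) ^ 2
  cross : c ^ 2 * (den k * 16 ^ suc k) ≡ (a * 16 ^ suc k + b * den k) * d
  cross = begin
    c ^ 2 * (den k * (16 * d))
      ≡⟨ tail-step-expand k c d ⟩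
    a * (16 * d) * d + 4 * d * d * (2 * (suc (2 * k) * c)) ^ 2
      ≡⟨ cong (λ t → a * (16 * d) * d + 4 * d * d * t ^ 2) (central-ratio k) ⟨
    a * (16 * d) * d + 4 * d * d * (suc k * central (suc k)) ^ 2
      ≡⟨ tail-step-collect k c (central (suc k)) d ⟩
    (a * (16 * d) + b * den k) * d ∎

private
  cancel-right : ∀ x y → x ≡ (x ℚ.+ y) ℚ.- y
  cancel-right = ℚ-Ring.solve 2 (λ x y → x := (x :+ y) :- y) refl
    where open ℚ-Ring
  chain : ∀ a b → (1ℚ ℚ.- a) ℚ.+ (a ℚ.- b) ≡ 1ℚ ℚ.- b
  chain = ℚ-Ring.solve 2 (λ a b → (con 1ℚ :- a) :+ (a :- b) := con 1ℚ :- b) refl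
    where open ℚ-Ring

term-difference : ∀ k → term k ≡ A k ℚ.- A (suc k)
term-difference k = trans (cancel-right (term k) (A (suc k))) (cong (ℚ._- A (suc k)) (sym (tail-step k)))

-- Telescoping (A 0 = 1):  Σ_{k=0}^{n} term k = 1 - A (n+1).
sum-telescopes : ∀ n → sumTo n term ≡ 1ℚ ℚ.- A (suc n)
sum-telescopes zero    = term-difference 0
sum-telescopes (suc n) = trans (cong₂ ℚ._+_ (sum-telescopes n) (term-difference (suc n)))
  (chain (A (suc n)) (A (suc (suc n))))

private
  difference-expand : ∀ x y d b →
    ((1ℚ ℚ.- x) ℚ.- (1ℚ ℚ.- y)) ℚ.* (d ℚ.* b) ≡ y ℚ.* (d ℚ.* b) ℚ.- (x ℚ.* d) ℚ.* b
  difference-expand = ℚ-Ring.solve 4 (λ x y d b →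
    ((con 1ℚ :- x) :- (con 1ℚ :- y)) :* (d :* b) := y :* (d :* b) :- (x :* d) :* b) refl
    where open ℚ-Ring
  cancel-left : ∀ u v → (u ℚ.+ v) ℚ.- u ≡ v
  cancel-left = ℚ-Ring.solve 2 (λ u v → (u :+ v) :- u := v) refl
    where open ℚ-Ring
  sub-add : ∀ u v → u ≡ (u ℤ.- v) ℤ.+ v
  sub-add = ℤ-Ring.solve-∀
  distribute : ∀ Q Y t P → Q ℤ.* (t ℤ.* P ℤ.+ Y) ≡ Q ℤ.* Y ℤ.+ (Q ℤ.* P) ℤ.* t
  distribute = ℤ-Ring.solve-∀

scaled-difference : ∀ Q X D B .{{_ : NonZero D}} →
  ((1ℚ ℚ.- + X ℚ./ D) ℚ.- (1ℚ ℚ.- ι (+ Q))) ℚ.* ι (+ (D * B)) ≡ ι (+ Q ℤ.* + (D * B)) ℚ.- ι (+ (X * B))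
scaled-difference Q X D B = begin
  ((1ℚ ℚ.- x) ℚ.- (1ℚ ℚ.- ι (+ Q))) ℚ.* ι (+ (D * B))
    ≡⟨ cong (((1ℚ ℚ.- x) ℚ.- (1ℚ ℚ.- ι (+ Q))) ℚ.*_) (trans (cong ι (ℤP.pos-* D B)) (ι-* (+ D) (+ B))) ⟩
  ((1ℚ ℚ.- x) ℚ.- (1ℚ ℚ.- ι (+ Q))) ℚ.* (ι (+ D) ℚ.* ι (+ B))
    ≡⟨ difference-expand x (ι (+ Q)) (ι (+ D)) (ι (+ B)) ⟩
  ι (+ Q) ℚ.* (ι (+ D) ℚ.* ι (+ B)) ℚ.- (x ℚ.* ι (+ D)) ℚ.* ι (+ B)
    ≡⟨ cong₂ (λ u v → ι (+ Q) ℚ.* u ℚ.- v ℚ.* ι (+ B)) (sym (ι-* (+ D) (+ B))) (/-*-cancel (+ X) D) ⟩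
  ι (+ Q) ℚ.* ι (+ D ℤ.* + B) ℚ.- ι (+ X) ℚ.* ι (+ B)
    ≡⟨ cong₂ ℚ._-_ (sym (ι-* (+ Q) (+ D ℤ.* + B))) (sym (ι-* (+ X) (+ B))) ⟩
  ι (+ Q ℤ.* (+ D ℤ.* + B)) ℚ.- ι (+ X ℤ.* + B)
    ≡⟨ cong₂ (λ u v → ι (+ Q ℤ.* u) ℚ.- ι v) (sym (ℤP.pos-* D B)) (sym (ℤP.pos-* X B)) ⟩
  ι (+ Q ℤ.* + (D * B)) ℚ.- ι (+ (X * B)) ∎
  where
  open ≡-Reasoning
  x = + X ℚ./ D

tail-numerator : ∀ {p e Q X B Y DB t} → p ^ e ≡ Q * p → X * B ≡ Q * Y →
  + DB ℤ.- + Y ≡ t ℤ.* + p → + Q ℤ.* + DB ≡ + (X * B) ℤ.+ + (p ^ e) ℤ.* t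
tail-numerator {p} {e} {Q} {X} {B} {Y} {DB} {t} pᵉ≡Qp XB≡QY DB-Y≡tp = begin
  + Q ℤ.* + DB                        ≡⟨ cong (+ Q ℤ.*_) (trans (sub-add (+ DB) (+ Y)) (cong (ℤ._+ + Y) DB-Y≡tp)) ⟩
  + Q ℤ.* (t ℤ.* + p ℤ.+ + Y)         ≡⟨ distribute (+ Q) (+ Y) t (+ p) ⟩
  + Q ℤ.* + Y ℤ.+ (+ Q ℤ.* + p) ℤ.* t ≡⟨ cong₂ (λ u v → u ℤ.+ v ℤ.* t) (cast Q Y XB≡QY) (cast Q p pᵉ≡Qp) ⟨
  + (X * B) ℤ.+ + (p ^ e) ℤ.* t       ∎
  where
  open ≡-Reasoning
  cast : ∀ {m} a b → m ≡ a * b → + m ≡ + a ℤ.* + b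
  cast a b eq = trans (cong +_ eq) (ℤP.pos-* a b)

-- The tail of the series modulo a power of p.  To compare 1 - X/D with 1 - Q where
-- Q p = p^e, it suffices to find a multiplier B with X B = Q Y in ℕ and
-- D B ≡ Y ≡ c (mod p) for a unit c: then (Q - X/D) D B = Q (D B - Y) ∈ p^e ℤ.
tail-congruence : ∀ p e Q X D B Y c .{{_ : NonZero D}} → p ^ e ≡ Q * p → ¬ p ∣ c →
  let open Congruence p in
  + (D * B) ≈ + c → + Y ≈ + c → X * B ≡ Q * Y →
  (1ℚ ℚ.- + X ℚ./ D) ≡ 1ℚ ℚ.- + Q ℚ./ 1 [modPow p ^ e ]
tail-congruence p e Q X D B Y c pᵉ≡Qp p∤c DB≈c Y≈c XB≡QY = t , D * B , p∤DB , (begin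
  ((1ℚ ℚ.- + X ℚ./ D) ℚ.- (1ℚ ℚ.- ι (+ Q))) ℚ.* ι (+ (D * B))
    ≡⟨ scaled-difference Q X D B ⟩
  ι (+ Q ℤ.* + (D * B)) ℚ.- ι (+ (X * B))
    ≡⟨ cong (λ u → ι u ℚ.- ι (+ (X * B)))
         (tail-numerator {p} {e} {Q} {X} {B} {Y} {D * B} {t} pᵉ≡Qp XB≡QY DB-Y≡tp) ⟩
  ι (+ (X * B) ℤ.+ + (p ^ e) ℤ.* t) ℚ.- ι (+ (X * B))
    ≡⟨ cong (ℚ._- ι (+ (X * B))) (ι-+ (+ (X * B)) (+ (p ^ e) ℤ.* t)) ⟩
  (ι (+ (X * B)) ℚ.+ ι (+ (p ^ e) ℤ.* t)) ℚ.- ι (+ (X * B))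
    ≡⟨ cancel-left (ι (+ (X * B))) (ι (+ (p ^ e) ℤ.* t)) ⟩
  ι (+ (p ^ e) ℤ.* t)
    ≡⟨ ι-* (+ (p ^ e)) t ⟩
  ι (+ (p ^ e)) ℚ.* ι t ∎)
  where
  open Congruence p
  open ≡-Reasoning
  DB≈Y : + (D * B) ≈ + Y
  DB≈Y = ≈-trans DB≈c (≈-sym Y≈c)
  t : ℤ
  t = _∣ℤ_.quotient (_≈_.divides-difference DB≈Y)
  DB-Y≡tp : + (D * B) ℤ.- + Y ≡ t ℤ.* + p
  DB-Y≡tp = _∣ℤ_.equality (_≈_.divides-difference DB≈Y)
  p∤DB : ¬ p ∣ D * B
  p∤DB p∣DB = p∤c (≈-∣ DB≈c p∣DB)

module AroundOddRow {p h : ℕ} (p-prime : Prime p) (p≢2 : p ≢ 2) (p∣q : p ∣ suc (2 * h))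
  (interior : ∀ {k} → 0 < k → k < suc (2 * h) → p ∣ suc (2 * h) C k) where

  open Congruence p
  open InteriorDivisible p (2 * h) interior

  private
    fourfold : ∀ h → 4 * suc h ≡ suc (2 * h) * 2 + 2
    fourfold = ℕ-Ring.solve-∀
    double-succ : ∀ h → 2 * suc h ≡ suc (2 * h) + 1
    double-succ = ℕ-Ring.solve-∀

  -- The first tail is A (h+1) = X₁ / D₁; it is cleared by the multiplier B₁ = (q+1)^2,
  -- and X₁ B₁ = q² Y₁.
  X₁ D₁ B₁ Y₁ : ℕ
  X₁ = central (suc h) ^ 2
  D₁ = 16 ^ suc h
  B₁ = 2 * suc h * (2 * suc h)
  Y₁ = 16 * (central h * central h)

  first-denominator : + (D₁ * B₁) ≈ + 16
  first-denominator = *-cong-ℕ sixteen-pow (*-self-ℕ q+1≈1)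
    where
    sixteen-pow : + (16 ^ suc h) ≈ + 16
    sixteen-pow = begin
      + (16 ^ suc h)      ≡⟨ cong +_ (^-*-assoc 2 4 (suc h)) ⟩
      + (2 ^ (4 * suc h)) ≡⟨ cong (λ t → + (2 ^ t)) (fourfold h) ⟩
      + (2 ^ (q * 2 + 2)) ≡⟨ cong +_ (^-distribˡ-+-* 2 (q * 2) 2) ⟩
      + (2 ^ (q * 2) * 4) ≈⟨ *-cong-ℕ (two-pow-multiple 2) ≈-refl ⟩
      + 16                ∎
      where open ≈-Reasoning
    q+1≈1 : + (2 * suc h) ≈ + 1
    q+1≈1 = begin
      + (2 * suc h) ≡⟨ cong +_ (double-succ h) ⟩
      + (q + 1)     ≈⟨ +-cong-ℕ (∣⇒≈0 p∣q) ≈-refl ⟩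
      + 1           ∎
      where open ≈-Reasoning

  -- Y₁ = 16 C(2h,h)^2 ≡ 16, since C(2h,h) ≡ ±1.
  first-numerator : + Y₁ ≈ + 16
  first-numerator = *-cong-ℕ {16} ≈-refl (begin
    + (central h * central h) ≈⟨ *-self-ℕ (alternating h (m≤m+n h (h + 0))) ⟩
    sign h ℤ.* sign h         ≡⟨ sign-square h ⟩
    + 1                       ∎)
    where open ≈-Reasoning

  private
    square-out : ∀ h c′ → c′ * (c′ * 1) * (2 * suc h * (2 * suc h)) ≡ 4 * (suc h * c′ * (suc h * c′))
    square-out = ℕ-Ring.solve-∀
    square-in : ∀ q c → 4 * (2 * (q * c) * (2 * (q * c))) ≡ q * q * (16 * (c * c))
    square-in = ℕ-Ring.solve-∀

  -- X₁ B₁ = q² Y₁, from  (h+1) C(2h+2,h+1) = 2q C(2h,h).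
  first-product : X₁ * B₁ ≡ q * q * Y₁
  first-product = begin
    central (suc h) ^ 2 * (2 * suc h * (2 * suc h))           ≡⟨ square-out h (central (suc h)) ⟩
    4 * (suc h * central (suc h) * (suc h * central (suc h))) ≡⟨ cong (λ t → 4 * (t * t)) (central-ratio h) ⟩
    4 * (2 * (q * central h) * (2 * (q * central h)))         ≡⟨ square-in q (central h) ⟩
    q * q * (16 * (central h * central h))                    ∎
    where open ≡-Reasoning

  -- The second tail is A (2h) = X₂ / D₂; it is cleared by the multiplier B₂ = (8m)^2
  -- with m = 4h+1 = 2q - 1, and X₂ B₂ = q² Y₂.
  m X₂ D₂ B₂ Y₂ : ℕ
  m  = suc (2 * (2 * h))
  X₂ = central (2 * h) ^ 2
  D₂ = 16 ^ (2 * h)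
  B₂ = 8 * m * (8 * m)
  Y₂ = 16 * (central q * central q)

  private
    sixteen-odd : ∀ h → suc (2 * h) * 4 ≡ 4 * suc (2 * h)
    sixteen-odd h = *-comm (suc (2 * h)) 4
    regroup-16 : ∀ d m → d * (8 * m * (8 * m)) ≡ (d * 16) * (4 * (m * m))
    regroup-16 = ℕ-Ring.solve-∀
    m+1 : ∀ h → suc (2 * (2 * h)) + 1 ≡ 2 * suc (2 * h)
    m+1 = ℕ-Ring.solve-∀
    pred-form : ∀ x → x ≡ (x ℤ.+ + 1) ℤ.- + 1
    pred-form = ℤ-Ring.solve-∀

  m≈-1 : + m ≈ - + 1
  m≈-1 = begin
    + m                   ≡⟨ pred-form (+ m) ⟩
    (+ m ℤ.+ + 1) ℤ.- + 1 ≡⟨ cong (ℤ._- + 1) (trans (sym (ℤP.pos-+ m 1)) (cong +_ (m+1 h))) ⟩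
    + (2 * q) ℤ.- + 1     ≈⟨ +-cong (∣⇒≈0 (∣n⇒∣m*n 2 p∣q)) (≈-refl { - + 1 }) ⟩
    0ℤ ℤ.- + 1            ∎
    where open ≈-Reasoning

  second-denominator : + (D₂ * B₂) ≈ + 64
  second-denominator = begin
    + (16 ^ (2 * h) * (8 * m * (8 * m)))    ≡⟨ cong +_ (regroup-16 (16 ^ (2 * h)) m) ⟩
    + ((16 ^ (2 * h) * 16) * (4 * (m * m))) ≈⟨ *-cong-ℕ sixteen-pow (*-cong-ℕ {4} ≈-refl (*-self-ℕ m≈-1)) ⟩
    + 64                                    ∎
    where
    open ≈-Reasoning
    sixteen-pow : + (16 ^ (2 * h) * 16) ≈ + 16
    sixteen-pow = begin
      + (16 ^ (2 * h) * 16) ≡⟨ cong +_ (*-comm (16 ^ (2 * h)) 16) ⟩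
      + (16 ^ q)            ≡⟨ cong +_ (^-*-assoc 2 4 q) ⟩
      + (2 ^ (4 * q))       ≡⟨ cong (λ t → + (2 ^ t)) (sym (sixteen-odd h)) ⟩
      + (2 ^ (q * 4))       ≈⟨ two-pow-multiple 4 ⟩
      + 16                  ∎

  -- Y₂ = 16 C(2q,q)^2 ≡ 64, since C(2q,q) ≡ 2.
  second-numerator : + Y₂ ≈ + 64
  second-numerator = *-cong-ℕ {16} ≈-refl (*-self-ℕ central-≈-2)

  private
    square-out₂ : ∀ m c → c * (c * 1) * (8 * m * (8 * m)) ≡ 16 * (2 * (m * c) * (2 * (m * c)))
    square-out₂ = ℕ-Ring.solve-∀
    square-in₂ : ∀ q f → 16 * (q * f * (q * f)) ≡ q * q * (16 * (f * f))
    square-in₂ = ℕ-Ring.solve-∀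

  -- X₂ B₂ = q² Y₂, from  q C(2q,q) = 2m C(2q-2,q-1).
  second-product : X₂ * B₂ ≡ q * q * Y₂
  second-product = begin
    central (2 * h) ^ 2 * (8 * m * (8 * m))                        ≡⟨ square-out₂ m (central (2 * h)) ⟩
    16 * (2 * (m * central (2 * h)) * (2 * (m * central (2 * h)))) ≡⟨ cong (λ t → 16 * (t * t)) (central-ratio (2 * h)) ⟨
    16 * (q * central q * (q * central q))                         ≡⟨ square-in₂ q (central q) ⟩
    q * q * (16 * (central q * central q))                         ∎
    where open ≡-Reasoning

  first-tail : ∀ Q e → Q ≡ q * q → p ^ e ≡ Q * p →
    (1ℚ ℚ.- A (suc h)) ≡ 1ℚ ℚ.- + Q ℚ./ 1 [modPow p ^ e ]
  first-tail Q e Q≡q² pᵉ≡Qp = tail-congruence p e Q X₁ D₁ B₁ Y₁ 16 {{m^n≢0 16 (suc h)}}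
    pᵉ≡Qp (prime∤2^ p-prime p≢2 4) first-denominator first-numerator
    (trans first-product (cong (_* Y₁) (sym Q≡q²)))

  second-tail : ∀ Q e → Q ≡ q * q → p ^ e ≡ Q * p →
    (1ℚ ℚ.- A (2 * h)) ≡ 1ℚ ℚ.- + Q ℚ./ 1 [modPow p ^ e ]
  second-tail Q e Q≡q² pᵉ≡Qp = tail-congruence p e Q X₂ D₂ B₂ Y₂ 64 {{m^n≢0 16 (2 * h)}}
    pᵉ≡Qp (prime∤2^ p-prime p≢2 6) second-denominator second-numerator
    (trans second-product (cong (_* Y₂) (sym Q≡q²)))

  first-congruence : ∀ Q e → Q ≡ q * q → p ^ e ≡ Q * p →
    sumTo ((q ∸ 1) / 2) term ≡ 1ℚ ℚ.- + Q ℚ./ 1 [modPow p ^ e ]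
  first-congruence Q e Q≡q² pᵉ≡Qp = subst (λ S → S ≡ 1ℚ ℚ.- + Q ℚ./ 1 [modPow p ^ e ])
    (sym (trans (cong (λ n → sumTo n term) (half-index h)) (sum-telescopes h)))
    (first-tail Q e Q≡q² pᵉ≡Qp)

  second-congruence : ∀ Q e → Q ≡ q * q → p ^ e ≡ Q * p →
    sumTo (q ∸ 2) term ≡ 1ℚ ℚ.- + Q ℚ./ 1 [modPow p ^ e ]
  second-congruence Q e Q≡q² pᵉ≡Qp = subst (λ S → S ≡ 1ℚ ℚ.- + Q ℚ./ 1 [modPow p ^ e ])
    (sym (trans (sum-telescopes (q ∸ 2)) (cong (λ n → 1ℚ ℚ.- A n) (last-index {p} {h} p-prime p∣q))))
    (second-tail Q e Q≡q² pᵉ≡Qp)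

corollary4p4 : (p r : ℕ) → Prime p → p ≢ 2 → 1 ≤ r →
    (sumTo (((p ^ r) ∸ 1) / 2) term ≡ 1ℚ -ℚ (+ (p ^ (2 * r)) /ℚ 1) [modPow p ^ (2 * r + 1) ])
    × (sumTo ((p ^ r) ∸ 2) term ≡ 1ℚ -ℚ (+ (p ^ (2 * r)) /ℚ 1) [modPow p ^ (2 * r + 1) ])
corollary4p4 p r p-prime p≢2 1≤r with odd-power p-prime p≢2 r
... | h , pʳ≡q = at-power (λ q → (q ∸ 1) / 2) (first-congruence Q e Q≡q² pᵉ≡Qp)
               , at-power (λ q → q ∸ 2) (second-congruence Q e Q≡q² pᵉ≡Qp)
  where
  Q = p ^ (2 * r)
  e = 2 * r + 1
  p∣q : p ∣ suc (2 * h)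
  p∣q = subst (p ∣_) pʳ≡q (∣-power 1≤r)
  interior : ∀ {k} → 0 < k → k < suc (2 * h) → p ∣ suc (2 * h) C k
  interior {k} 0<k k<q = subst (λ n → p ∣ n C k) pʳ≡q
    (prime-power-∣-binomial p-prime r 0<k (subst (k <_) (sym pʳ≡q) k<q))
  open AroundOddRow {p} {h} p-prime p≢2 p∣q interior using (first-congruence; second-congruence)
  Q≡q² : Q ≡ suc (2 * h) * suc (2 * h)
  Q≡q² = trans (power-double p r) (cong₂ _*_ pʳ≡q pʳ≡q)
  pᵉ≡Qp : p ^ e ≡ Q * p
  pᵉ≡Qp = power-succ p (2 * r)
  at-power : ∀ (range : ℕ → ℕ) → sumTo (range (suc (2 * h))) term ≡ 1ℚ -ℚ (+ Q /ℚ 1) [modPow p ^ e ] →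
    sumTo (range (p ^ r)) term ≡ 1ℚ -ℚ (+ Q /ℚ 1) [modPow p ^ e ]
  at-power range = subst (λ n → sumTo (range n) term ≡ 1ℚ -ℚ (+ Q /ℚ 1) [modPow p ^ e ]) (sym pʳ≡q)
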